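{- Let $n$ and $k$ be even positive integers with $k$ dividing $n$, and let $C$ be the $2k$-cycle in $Q_n$ with initial vertex $\emptyset$ and edge direction sequence $(1,2,\ldots,k,1,2,\ldots,k)$. Then $C$ divides $Q_n$.
   Context: $Q_n$ is the $n$-dimensional hypercube: vertex set the subsets of $\{1,\ldots,n\}$, with $x,y$ adjacent iff $|x\,\Delta\, y|=1$. A walk is described by its starting vertex and the sequence of directions of its edges: from vertex $x$, a step in direction $i$ goes to $x\,\Delta\,\{i\}$. If $H$ is isomorphic to a subgraph of $G$, $H$ divides $G$ if there exist embeddings $\theta_1,\ldots,\theta_r$ of $H$ into $G$ such that $\{E(\theta_1(H)),\ldots,E(\theta_r(H))\}$ is a partition of $E(G)$. -}

module Defs where

open import Data.Nat using (ℕ; zero; suc; _*_; _<_; _≤_; NonZero)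
open import Data.Nat.Properties using (<-≤-trans)
open import Data.Nat.DivMod using (_%_; m%n<n)
open import Data.Fin using (Fin; fromℕ<)
open import Data.Fin.Subset using (Subset; _∪_; _─_; ∣_∣; ⁅_⁆; ⊥)
open import Data.Product using (Σ; ∃-syntax; _×_)
open import Data.Sum using (_⊎_)
open import Relation.Binary.PropositionalEquality using (_≡_)

-- Vertices of Q_n: subsets of {1..n}, represented as Subset n (Fin n ≅ {1..n},
-- direction i ∈ {1..n} corresponds to index i-1 : Fin n).

_Δ_ : ∀ {n} → Subset n → Subset n → Subset n
x Δ y = (x ─ y) ∪ (y ─ x)

Adj : ∀ {n} → Subset n → Subset n → Set
Adj x y = ∣ x Δ y ∣ ≡ 1

walk : ∀ {n} → Subset n → (ℕ → Fin n) → ℕ → Subset n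
walk s dir zero    = s
walk s dir (suc j) = walk s dir j Δ ⁅ dir j ⁆

-- A closed walk w of length L (w L = w 0) viewed as a subgraph H of Q_n:
-- V(H) = { w j | j < L },  E(H) = { {w j , w (j+1)} | j < L }.

Embedding : ∀ {n} → ℕ → (ℕ → Subset n) → (Subset n → Subset n) → Set
Embedding L w θ =
  (∀ i j → i < L → j < L → θ (w i) ≡ θ (w j) → w i ≡ w j)
  × (∀ j → j < L → Adj (θ (w j)) (θ (w (suc j))))

EdgeIn : ∀ {n} → ℕ → (ℕ → Subset n) → (Subset n → Subset n) → Subset n → Subset n → Set
EdgeIn L w θ x y = ∃[ j ] (j < L ×
  ((θ (w j) ≡ x × θ (w (suc j)) ≡ y) ⊎ (θ (w j) ≡ y × θ (w (suc j)) ≡ x)))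

DividesQ : (n : ℕ) → ℕ → (ℕ → Subset n) → Set
DividesQ n L w = ∃[ r ] Σ (Fin r → Subset n → Subset n) λ θ →
  (∀ i → Embedding L w (θ i))
  × (∀ x y → Adj x y →
       (∃[ i ] EdgeIn L w (θ i) x y)
       × (∀ i i' → EdgeIn L w (θ i) x y → EdgeIn L w (θ i') x y → i ≡ i'))

-- direction sequence (1,2,...,k,1,2,...,k,...) : step j goes in direction (j mod k) + 1,
-- i.e. index j % k in Fin n.
cDir : (n k : ℕ) .{{_ : NonZero k}} → k ≤ n → ℕ → Fin n
cDir n k k≤n j = fromℕ< (<-≤-trans (m%n<n j k) k≤n)

cWalk : (n k : ℕ) .{{_ : NonZero k}} → k ≤ n → ℕ → Subset n
cWalk n k k≤n = walk ⊥ (cDir n k k≤n)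

module Submission where

-- Write k = 2(h+1), n = (q+1)k, and split the coordinates into q+1 blocks of k; C uses
-- each direction of block 0 twice, at steps p and p + k, and its vertex at time p + k
-- is its vertex at time p translated by F = C_k (the whole of block 0).  The copies of
-- C are its images under the automorphisms z ↦ σ_b (c Δ z) of Q_n, where σ_b exchanges
-- block 0 with block b and c runs over the 2^(n-2) canonical vertices (coordinate 0
-- absent, even size).  An edge in direction (block b, position p) is traversed by the
-- copy (b, c) iff, pulled back by σ_b, one of its endpoints is c Δ C_p or c Δ C_p Δ F.
-- The two endpoints have different parities while translates by canonical vertices and
-- by F preserve parity, so parity selects the endpoint; as coordinate 0 lies in F and
-- not in c, it then selects between the two translates.

open import Defs
open import Data.Nat
  using (ℕ; zero; suc; _+_; _∸_; _*_; _^_; _≤_; _<_; _<?_; NonZero; ≢-nonZero⁻¹)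
open import Data.Nat.Properties
  using ( suc-injective; 0≢1+n; n<1+n; <-trans; <-≤-trans; m≤m+n; +-identityʳ; ≮⇒≥
        ; m∸n+n≡m; +-cancelʳ-<; +-monoˡ-<)
open import Data.Nat.DivMod using (_%_; m%n<n; [m+n]%n≡m%n; m<n⇒m%n≡m)
open import Data.Nat.Divisibility using (_∣_; ∣⇒≤; divides)
open import Data.Bool using (Bool; true; false; not; _xor_)
import Data.Bool.Properties as Bool
open import Data.Bool.Properties
  using ( xor-assoc; xor-comm; xor-same; xor-identityʳ; true-xor; not-involutive
        ; not-¬; ¬-not; xor-∧-commutativeRing)
open import Data.Fin
  using (Fin; zero; suc; toℕ; fromℕ<; combine; remQuot; finToFun; funToFin)
open import Data.Fin.Properties
  using ( _≟_; toℕ-injective; toℕ-fromℕ<; toℕ-↑ˡ; toℕ<n; *↔×; combine-injective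
        ; remQuot-combine; combine-remQuot; 2↔Bool; finToFun-funToFin; funToFin-finToFin)
open import Data.Fin.Permutation
  using (Permutation′; transpose; _⟨$⟩ʳ_; _⟨$⟩ˡ_; flip; inverseˡ; inverseʳ)
open import Data.Fin.Subset using (Subset; ⁅_⁆; ∣_∣; ⊥; _∈_)
open import Data.Fin.Subset.Properties using (∣⁅x⁆∣≡1; x∈⁅x⁆; x∈⁅y⁆⇒x≡y)
open import Data.Vec using (Vec; []; _∷_; lookup; tabulate; zipWith; tail)
open import Data.Vec.Properties
  using ( lookup∘tabulate; tabulate∘lookup; tabulate-cong; lookup-zipWith
        ; zipWith-assoc; zipWith-comm; zipWith-identityˡ)
open import Data.Product using (_,_; proj₁; proj₂; ∃-syntax; _×_)
open import Data.Product.Function.NonDependent.Propositional using (_×-↔_)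
open import Data.Sum using (_⊎_; inj₁; inj₂)
open import Function using (_∘_; _⇔_; mk⇔; _↔_; Inverse; mk↔ₛ′)
open import Function.Construct.Composition using (_↔-∘_)
open import Function.Construct.Symmetry using (↔-sym)
open import Function.Construct.Identity using (↔-id)
open import Relation.Nullary using (does; yes; no; contradiction)
open import Relation.Nullary.Decidable using (does-⇔; dec-false)
open import Relation.Binary.PropositionalEquality
open import Algebra.Bundles using (CommutativeRing)
open import Algebra.Properties.CommutativeSemigroup
  (CommutativeRing.+-commutativeSemigroup xor-∧-commutativeRing) using (interchange)

lookup-ext : ∀ {n} {A : Set} {x y : Vec A n} → (∀ t → lookup x t ≡ lookup y t) → x ≡ y
lookup-ext {x = x} {y} eq = begin
  x                   ≡⟨ tabulate∘lookup x ⟨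
  tabulate (lookup x) ≡⟨ tabulate-cong eq ⟩
  tabulate (lookup y) ≡⟨ tabulate∘lookup y ⟩
  y                   ∎
  where open ≡-Reasoning

Δ-cons : ∀ {n} a b (x y : Subset n) → (a ∷ x) Δ (b ∷ y) ≡ (a xor b) ∷ (x Δ y)
Δ-cons true  true  x y = refl
Δ-cons true  false x y = refl
Δ-cons false true  x y = refl
Δ-cons false false x y = refl

Δ≡xor : ∀ {n} (x y : Subset n) → x Δ y ≡ zipWith _xor_ x y
Δ≡xor []      []      = refl
Δ≡xor (a ∷ x) (b ∷ y) = trans (Δ-cons a b x y) (cong ((a xor b) ∷_) (Δ≡xor x y))

lookup-Δ : ∀ {n} (x y : Subset n) t → lookup (x Δ y) t ≡ lookup x t xor lookup y t
lookup-Δ x y t rewrite Δ≡xor x y = lookup-zipWith _xor_ t x y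

Δ-assoc : ∀ {n} (x y z : Subset n) → (x Δ y) Δ z ≡ x Δ (y Δ z)
Δ-assoc x y z
  rewrite Δ≡xor x y | Δ≡xor y z | Δ≡xor (zipWith _xor_ x y) z | Δ≡xor x (zipWith _xor_ y z)
  = zipWith-assoc xor-assoc x y z

Δ-comm : ∀ {n} (x y : Subset n) → x Δ y ≡ y Δ x
Δ-comm x y rewrite Δ≡xor x y | Δ≡xor y x = zipWith-comm xor-comm x y

Δ-identityˡ : ∀ {n} (x : Subset n) → ⊥ Δ x ≡ x
Δ-identityˡ x rewrite Δ≡xor ⊥ x = zipWith-identityˡ (λ _ → refl) x

Δ-identityʳ : ∀ {n} (x : Subset n) → x Δ ⊥ ≡ x
Δ-identityʳ x = trans (Δ-comm x ⊥) (Δ-identityˡ x)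

Δ-self : ∀ {n} (x : Subset n) → x Δ x ≡ ⊥
Δ-self []      = refl
Δ-self (a ∷ x) = trans (Δ-cons a a x x) (cong₂ _∷_ (xor-same a) (Δ-self x))

Δ-cancelʳ : ∀ {n} (x y : Subset n) → (x Δ y) Δ y ≡ x
Δ-cancelʳ x y = begin
  (x Δ y) Δ y ≡⟨ Δ-assoc x y y ⟩
  x Δ (y Δ y) ≡⟨ cong (x Δ_) (Δ-self y) ⟩
  x Δ ⊥       ≡⟨ Δ-identityʳ x ⟩
  x           ∎
  where open ≡-Reasoning

Δ-cancelˡ : ∀ {n} (x y : Subset n) → x Δ (x Δ y) ≡ y
Δ-cancelˡ x y = begin
  x Δ (x Δ y) ≡⟨ Δ-assoc x x y ⟨
  (x Δ x) Δ y ≡⟨ cong (_Δ y) (Δ-self x) ⟩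
  ⊥ Δ y       ≡⟨ Δ-identityˡ y ⟩
  y           ∎
  where open ≡-Reasoning

Δ-injectiveˡ : ∀ {n} (c x y : Subset n) → c Δ x ≡ c Δ y → x ≡ y
Δ-injectiveˡ c x y eq = trans (sym (Δ-cancelˡ c x)) (trans (cong (c Δ_) eq) (Δ-cancelˡ c y))

Δ-injectiveʳ : ∀ {n} (c x y : Subset n) → x Δ c ≡ y Δ c → x ≡ y
Δ-injectiveʳ c x y eq = trans (sym (Δ-cancelʳ x c)) (trans (cong (_Δ c) eq) (Δ-cancelʳ y c))

Δ-swapʳ : ∀ {n} (x y z : Subset n) → (x Δ y) Δ z ≡ (x Δ z) Δ y
Δ-swapʳ x y z = begin
  (x Δ y) Δ z ≡⟨ Δ-assoc x y z ⟩
  x Δ (y Δ z) ≡⟨ cong (x Δ_) (Δ-comm y z) ⟩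
  x Δ (z Δ y) ≡⟨ Δ-assoc x z y ⟨
  (x Δ z) Δ y ∎
  where open ≡-Reasoning

step-sym : ∀ {n} {x y e : Subset n} → x ≡ y Δ e → y ≡ x Δ e
step-sym {y = y} {e} x≡y+e = trans (sym (Δ-cancelʳ y e)) (cong (_Δ e) (sym x≡y+e))

lookup-⁅⁆ : ∀ {n} (e t : Fin n) → lookup ⁅ e ⁆ t ≡ does (e ≟ t)
lookup-⁅⁆ zero    zero    = refl
lookup-⁅⁆ zero    (suc t) = lookup-⊥ t
  where
  lookup-⊥ : ∀ {n} (t : Fin n) → lookup ⊥ t ≡ false
  lookup-⊥ zero    = refl
  lookup-⊥ (suc t) = lookup-⊥ t
lookup-⁅⁆ (suc e) zero    = refl
lookup-⁅⁆ (suc e) (suc t) = lookup-⁅⁆ e t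

⁅⁆-injective : ∀ {n} {d e : Fin n} → ⁅ d ⁆ ≡ ⁅ e ⁆ → d ≡ e
⁅⁆-injective {d = d} {e} eq = x∈⁅y⁆⇒x≡y e (subst (d ∈_) eq (x∈⁅x⁆ d))

∣z∣≡0⇒z≡⊥ : ∀ {n} (z : Subset n) → ∣ z ∣ ≡ 0 → z ≡ ⊥
∣z∣≡0⇒z≡⊥ []          _  = refl
∣z∣≡0⇒z≡⊥ (false ∷ z) eq = cong (false ∷_) (∣z∣≡0⇒z≡⊥ z eq)

∣z∣≡1⇒singleton : ∀ {n} (z : Subset n) → ∣ z ∣ ≡ 1 → ∃[ d ] z ≡ ⁅ d ⁆
∣z∣≡1⇒singleton (true  ∷ z) eq =
  zero , cong (true ∷_) (∣z∣≡0⇒z≡⊥ z (suc-injective eq))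
∣z∣≡1⇒singleton (false ∷ z) eq with ∣z∣≡1⇒singleton z eq
... | d , z≡⁅d⁆ = suc d , cong (false ∷_) z≡⁅d⁆

adj⇒step : ∀ {n} (x y : Subset n) → Adj x y → ∃[ d ] y ≡ x Δ ⁅ d ⁆
adj⇒step x y adj with ∣z∣≡1⇒singleton (x Δ y) adj
... | d , xΔy≡⁅d⁆ = d , trans (sym (Δ-cancelˡ x y)) (cong (x Δ_) xΔy≡⁅d⁆)

step⇒adj : ∀ {n} (x : Subset n) d → Adj x (x Δ ⁅ d ⁆)
step⇒adj x d = trans (cong ∣_∣ (Δ-cancelˡ x ⁅ d ⁆)) (∣⁅x⁆∣≡1 d)

parity : ∀ {n} → Subset n → Bool
parity []      = false
parity (a ∷ x) = a xor parity x

parity-⊥ : ∀ n → parity (⊥ {n}) ≡ false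
parity-⊥ zero    = refl
parity-⊥ (suc n) = parity-⊥ n

parity-⁅⁆ : ∀ {n} (e : Fin n) → parity ⁅ e ⁆ ≡ true
parity-⁅⁆ {suc n} zero    = cong (true xor_) (parity-⊥ n)
parity-⁅⁆         (suc e) = parity-⁅⁆ e

parity-Δ : ∀ {n} (x y : Subset n) → parity (x Δ y) ≡ parity x xor parity y
parity-Δ []      []      = refl
parity-Δ (a ∷ x) (b ∷ y) = begin
  parity ((a ∷ x) Δ (b ∷ y))            ≡⟨ cong parity (Δ-cons a b x y) ⟩
  (a xor b) xor parity (x Δ y)          ≡⟨ cong ((a xor b) xor_) (parity-Δ x y) ⟩
  (a xor b) xor (parity x xor parity y) ≡⟨ interchange a b (parity x) (parity y) ⟩
  (a xor parity x) xor (b xor parity y) ∎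
  where open ≡-Reasoning

parity-step : ∀ {n} (x : Subset n) e → parity (x Δ ⁅ e ⁆) ≡ not (parity x)
parity-step x e = begin
  parity (x Δ ⁅ e ⁆)        ≡⟨ parity-Δ x ⁅ e ⁆ ⟩
  parity x xor parity ⁅ e ⁆ ≡⟨ cong (parity x xor_) (parity-⁅⁆ e) ⟩
  parity x xor true         ≡⟨ xor-comm (parity x) true ⟩
  true xor parity x         ≡⟨ true-xor (parity x) ⟩
  not (parity x)            ∎
  where open ≡-Reasoning

Endpoint : ∀ {n} → Subset n → Fin n → Subset n → Set
Endpoint u e z = z ≡ u ⊎ z ≡ u Δ ⁅ e ⁆

endpoint-unique : ∀ {n} {u z z′ : Subset n} {e} →
  Endpoint u e z → Endpoint u e z′ → parity z ≡ parity z′ → z ≡ z′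
endpoint-unique (inj₁ z≡u)  (inj₁ z′≡u)  _ = trans z≡u (sym z′≡u)
endpoint-unique (inj₂ z≡u′) (inj₂ z′≡u′) _ = trans z≡u′ (sym z′≡u′)
endpoint-unique {u = u} {e = e} (inj₁ refl) (inj₂ refl) eq =
  contradiction (trans eq (parity-step u e)) (not-¬ refl)
endpoint-unique {u = u} {e = e} (inj₂ refl) (inj₁ refl) eq =
  contradiction (trans (sym eq) (parity-step u e)) (not-¬ refl)

endpoint-of-parity : ∀ {n} (u : Subset n) e b → ∃[ z ] Endpoint u e z × parity z ≡ b
endpoint-of-parity u e b with parity u Bool.≟ b
... | yes pu≡b = u , inj₁ refl , pu≡b
... | no  pu≢b = u Δ ⁅ e ⁆ , inj₂ refl , trans (parity-step u e) (sym (¬-not (pu≢b ∘ sym)))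

act : ∀ {n} → Permutation′ n → Subset n → Subset n
act ρ x = tabulate (λ t → lookup x (ρ ⟨$⟩ˡ t))

lookup-act : ∀ {n} (ρ : Permutation′ n) x t → lookup (act ρ x) t ≡ lookup x (ρ ⟨$⟩ˡ t)
lookup-act ρ x t = lookup∘tabulate (λ t → lookup x (ρ ⟨$⟩ˡ t)) t

act-flipʳ : ∀ {n} (ρ : Permutation′ n) x → act ρ (act (flip ρ) x) ≡ x
act-flipʳ ρ x = lookup-ext λ t → begin
  lookup (act ρ (act (flip ρ) x)) t  ≡⟨ lookup-act ρ (act (flip ρ) x) t ⟩
  lookup (act (flip ρ) x) (ρ ⟨$⟩ˡ t) ≡⟨ lookup-act (flip ρ) x (ρ ⟨$⟩ˡ t) ⟩
  lookup x (ρ ⟨$⟩ʳ (ρ ⟨$⟩ˡ t))       ≡⟨ cong (lookup x) (inverseʳ ρ) ⟩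
  lookup x t                         ∎
  where open ≡-Reasoning

act-flipˡ : ∀ {n} (ρ : Permutation′ n) x → act (flip ρ) (act ρ x) ≡ x
act-flipˡ ρ x = lookup-ext λ t → begin
  lookup (act (flip ρ) (act ρ x)) t  ≡⟨ lookup-act (flip ρ) (act ρ x) t ⟩
  lookup (act ρ x) (ρ ⟨$⟩ʳ t)        ≡⟨ lookup-act ρ x (ρ ⟨$⟩ʳ t) ⟩
  lookup x (ρ ⟨$⟩ˡ (ρ ⟨$⟩ʳ t))       ≡⟨ cong (lookup x) (inverseˡ ρ) ⟩
  lookup x t                         ∎
  where open ≡-Reasoning

act-injective : ∀ {n} (ρ : Permutation′ n) {x y} → act ρ x ≡ act ρ y → x ≡ y
act-injective ρ {x} {y} eq =
  trans (sym (act-flipˡ ρ x)) (trans (cong (act (flip ρ)) eq) (act-flipˡ ρ y))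

act-Δ : ∀ {n} (ρ : Permutation′ n) x y → act ρ (x Δ y) ≡ act ρ x Δ act ρ y
act-Δ ρ x y = lookup-ext λ t → begin
  lookup (act ρ (x Δ y)) t                    ≡⟨ lookup-act ρ (x Δ y) t ⟩
  lookup (x Δ y) (ρ ⟨$⟩ˡ t)                   ≡⟨ lookup-Δ x y (ρ ⟨$⟩ˡ t) ⟩
  lookup x (ρ ⟨$⟩ˡ t) xor lookup y (ρ ⟨$⟩ˡ t) ≡⟨ cong₂ _xor_ (lookup-act ρ x t)
                                                              (lookup-act ρ y t) ⟨
  lookup (act ρ x) t xor lookup (act ρ y) t   ≡⟨ lookup-Δ (act ρ x) (act ρ y) t ⟨
  lookup (act ρ x Δ act ρ y) t                ∎
  where open ≡-Reasoning

act-⁅⁆ : ∀ {n} (ρ : Permutation′ n) e → act ρ ⁅ e ⁆ ≡ ⁅ ρ ⟨$⟩ʳ e ⁆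
act-⁅⁆ ρ e = lookup-ext λ t → begin
  lookup (act ρ ⁅ e ⁆) t  ≡⟨ lookup-act ρ ⁅ e ⁆ t ⟩
  lookup ⁅ e ⁆ (ρ ⟨$⟩ˡ t) ≡⟨ lookup-⁅⁆ e (ρ ⟨$⟩ˡ t) ⟩
  does (e ≟ ρ ⟨$⟩ˡ t)     ≡⟨ does-⇔ moved (e ≟ ρ ⟨$⟩ˡ t) (ρ ⟨$⟩ʳ e ≟ t) ⟩
  does (ρ ⟨$⟩ʳ e ≟ t)     ≡⟨ lookup-⁅⁆ (ρ ⟨$⟩ʳ e) t ⟨
  lookup ⁅ ρ ⟨$⟩ʳ e ⁆ t   ∎
  where
  open ≡-Reasoning
  moved : ∀ {t} → (e ≡ ρ ⟨$⟩ˡ t) ⇔ (ρ ⟨$⟩ʳ e ≡ t)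
  moved = mk⇔ (λ eq → trans (cong (ρ ⟨$⟩ʳ_) eq) (inverseʳ ρ))
              (λ eq → trans (sym (inverseˡ ρ)) (cong (ρ ⟨$⟩ˡ_) eq))

pullback-step : ∀ {n} (ρ : Permutation′ n) x e →
  act (flip ρ) (x Δ ⁅ ρ ⟨$⟩ʳ e ⁆) ≡ act (flip ρ) x Δ ⁅ e ⁆
pullback-step ρ x e = begin
  act (flip ρ) (x Δ ⁅ ρ ⟨$⟩ʳ e ⁆)
    ≡⟨ act-Δ (flip ρ) x ⁅ ρ ⟨$⟩ʳ e ⁆ ⟩
  act (flip ρ) x Δ act (flip ρ) ⁅ ρ ⟨$⟩ʳ e ⁆
    ≡⟨ cong (act (flip ρ) x Δ_) (act-⁅⁆ (flip ρ) (ρ ⟨$⟩ʳ e)) ⟩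
  act (flip ρ) x Δ ⁅ ρ ⟨$⟩ˡ (ρ ⟨$⟩ʳ e) ⁆
    ≡⟨ cong (λ d → act (flip ρ) x Δ ⁅ d ⁆) (inverseˡ ρ) ⟩
  act (flip ρ) x Δ ⁅ e ⁆ ∎
  where open ≡-Reasoning

aut : ∀ {n} → Permutation′ n → Subset n → Subset n → Subset n
aut ρ c z = act ρ (c Δ z)

aut-step : ∀ {n} (ρ : Permutation′ n) c z e →
  aut ρ c (z Δ ⁅ e ⁆) ≡ aut ρ c z Δ ⁅ ρ ⟨$⟩ʳ e ⁆
aut-step ρ c z e = begin
  act ρ (c Δ (z Δ ⁅ e ⁆))      ≡⟨ cong (act ρ) (Δ-assoc c z ⁅ e ⁆) ⟨
  act ρ ((c Δ z) Δ ⁅ e ⁆)      ≡⟨ act-Δ ρ (c Δ z) ⁅ e ⁆ ⟩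
  act ρ (c Δ z) Δ act ρ ⁅ e ⁆  ≡⟨ cong (act ρ (c Δ z) Δ_) (act-⁅⁆ ρ e) ⟩
  act ρ (c Δ z) Δ ⁅ ρ ⟨$⟩ʳ e ⁆ ∎
  where open ≡-Reasoning

aut-preimage : ∀ {n} (ρ : Permutation′ n) c z x → aut ρ c z ≡ x → c Δ z ≡ act (flip ρ) x
aut-preimage ρ c z x eq = trans (sym (act-flipˡ ρ (c Δ z))) (cong (act (flip ρ)) eq)

aut-image : ∀ {n} (ρ : Permutation′ n) c z x → c Δ z ≡ act (flip ρ) x → aut ρ c z ≡ x
aut-image ρ c z x eq = trans (cong (act ρ) eq) (act-flipʳ ρ x)

aut-embedding : ∀ {n} L (s : Subset n) dir ρ c → Embedding L (walk s dir) (aut ρ c)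
aut-embedding L s dir ρ c =
  (λ i j _ _ eq → Δ-injectiveˡ c (walk s dir i) (walk s dir j) (act-injective ρ eq)) ,
  (λ j _ → subst (Adj (aut ρ c (walk s dir j))) (sym (aut-step ρ c (walk s dir j) (dir j)))
                 (step⇒adj (aut ρ c (walk s dir j)) (ρ ⟨$⟩ʳ dir j)))

-- The image of the walk (s, dir) under aut ρ c traverses the edge {x, y} at step j:
-- {x, y} has the direction ρ (dir j) of that step, and the translated vertex
-- c Δ walk s dir j is an endpoint of the pulled-back edge.
Traverses : ∀ {n} → ℕ → Subset n → (ℕ → Fin n) → Permutation′ n → Subset n →
  Subset n → Subset n → ℕ → Set
Traverses L s dir ρ c x y j =
  j < L × y ≡ x Δ ⁅ ρ ⟨$⟩ʳ dir j ⁆ × Endpoint (act (flip ρ) x) (dir j) (c Δ walk s dir j)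

module _ {n} (L : ℕ) (s : Subset n) (dir : ℕ → Fin n) (ρ : Permutation′ n) (c : Subset n) where
  private
    w : ℕ → Subset n
    w = walk s dir
    θ : Subset n → Subset n
    θ = aut ρ c
    D : ℕ → Subset n
    D j = ⁅ ρ ⟨$⟩ʳ dir j ⁆
    θ-step : ∀ j → θ (w (suc j)) ≡ θ (w j) Δ D j
    θ-step j = aut-step ρ c (w j) (dir j)

  aut-edge⁻ : ∀ x y → EdgeIn L w θ x y → ∃[ j ] Traverses L s dir ρ c x y j
  aut-edge⁻ x y (j , j<L , inj₁ (θwj≡x , θwj+1≡y)) =
    j , j<L , trans (sym θwj+1≡y) (trans (θ-step j) (cong (_Δ D j) θwj≡x)) ,
    inj₁ (aut-preimage ρ c (w j) x θwj≡x)
  aut-edge⁻ x y (j , j<L , inj₂ (θwj≡y , θwj+1≡x)) = j , j<L , y≡x+D , inj₂ (begin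
    c Δ w j                    ≡⟨ aut-preimage ρ c (w j) y θwj≡y ⟩
    act (flip ρ) y             ≡⟨ cong (act (flip ρ)) y≡x+D ⟩
    act (flip ρ) (x Δ D j)     ≡⟨ pullback-step ρ x (dir j) ⟩
    act (flip ρ) x Δ ⁅ dir j ⁆ ∎)
    where
    open ≡-Reasoning
    y≡x+D : y ≡ x Δ D j
    y≡x+D = step-sym (trans (sym θwj+1≡x) (trans (θ-step j) (cong (_Δ D j) θwj≡y)))

  aut-edge⁺ : ∀ x y j → Traverses L s dir ρ c x y j → EdgeIn L w θ x y
  aut-edge⁺ x y j (j<L , y≡x+D , inj₁ cwj≡u) =
    j , j<L , inj₁ (θwj≡x , trans (θ-step j) (trans (cong (_Δ D j) θwj≡x) (sym y≡x+D)))
    where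
    θwj≡x : θ (w j) ≡ x
    θwj≡x = aut-image ρ c (w j) x cwj≡u
  aut-edge⁺ x y j (j<L , y≡x+D , inj₂ cwj≡u+e) =
    j , j<L , inj₂ (θwj≡y , trans (θ-step j) (trans (cong (_Δ D j) θwj≡y) (sym (step-sym y≡x+D))))
    where
    θwj≡y : θ (w j) ≡ y
    θwj≡y = aut-image ρ c (w j) y (begin
      c Δ w j                    ≡⟨ cwj≡u+e ⟩
      act (flip ρ) x Δ ⁅ dir j ⁆ ≡⟨ pullback-step ρ x (dir j) ⟨
      act (flip ρ) (x Δ D j)     ≡⟨ cong (act (flip ρ)) y≡x+D ⟨
      act (flip ρ) y             ∎)
      where open ≡-Reasoning

walk-shift : ∀ {n} (dir : ℕ → Fin n) k → (∀ j → dir (j + k) ≡ dir j) →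
  ∀ j → walk ⊥ dir (j + k) ≡ walk ⊥ dir j Δ walk ⊥ dir k
walk-shift dir k periodic zero    = sym (Δ-identityˡ (walk ⊥ dir k))
walk-shift dir k periodic (suc j) = begin
  walk ⊥ dir (j + k) Δ ⁅ dir (j + k) ⁆ ≡⟨ cong₂ (λ z e → z Δ ⁅ e ⁆)
                                                 (walk-shift dir k periodic j) (periodic j) ⟩
  (walk ⊥ dir j Δ F) Δ ⁅ dir j ⁆       ≡⟨ Δ-swapʳ (walk ⊥ dir j) F ⁅ dir j ⁆ ⟩
  (walk ⊥ dir j Δ ⁅ dir j ⁆) Δ F       ∎
  where
  open ≡-Reasoning
  F : Subset _
  F = walk ⊥ dir k

parity-walk-even : ∀ {n} (s : Subset n) dir h → parity (walk s dir (h * 2)) ≡ parity s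
parity-walk-even s dir zero    = refl
parity-walk-even s dir (suc h) = begin
  parity ((x Δ ⁅ dir m ⁆) Δ ⁅ dir (suc m) ⁆) ≡⟨ parity-step (x Δ ⁅ dir m ⁆) (dir (suc m)) ⟩
  not (parity (x Δ ⁅ dir m ⁆))              ≡⟨ cong not (parity-step x (dir m)) ⟩
  not (not (parity x))                      ≡⟨ not-involutive (parity x) ⟩
  parity x                                  ≡⟨ parity-walk-even s dir h ⟩
  parity s                                  ∎
  where
  open ≡-Reasoning
  m : ℕ
  m = h * 2
  x : Subset _
  x = walk s dir m

blockPerm : ∀ {q} k → Permutation′ q → Permutation′ (q * k)
blockPerm k ρ = ↔-sym *↔× ↔-∘ ((ρ ×-↔ ↔-id _) ↔-∘ *↔×)

blockPerm-combine : ∀ {q} k (ρ : Permutation′ q) b p →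
  blockPerm k ρ ⟨$⟩ʳ combine b p ≡ combine (ρ ⟨$⟩ʳ b) p
blockPerm-combine {q} k ρ b p =
  cong (λ r → combine (ρ ⟨$⟩ʳ proj₁ r) (proj₂ r)) (remQuot-combine {q} {k} b p)

-- Vertices without coordinate 0 and of even parity.  They form a subgroup of index 4
-- and will be the translation vectors of the copies of C.
Canonical : ∀ {n} → Subset (suc n) → Set
Canonical c = lookup c zero ≡ false × parity c ≡ false

canon : ∀ {m} → Vec Bool m → Subset (suc (suc m))
canon s = false ∷ parity s ∷ s

canon-canonical : ∀ {m} (s : Vec Bool m) → Canonical (canon s)
canon-canonical s = refl , xor-same (parity s)

canon-injective : ∀ {m} {s s′ : Vec Bool m} → canon s ≡ canon s′ → s ≡ s′
canon-injective = cong (tail ∘ tail)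

canonical⇒canon : ∀ {m} (c : Subset (suc (suc m))) → Canonical c → ∃[ s ] canon s ≡ c
canonical⇒canon (false ∷ a ∷ s) (refl , even) = s , cong (λ b → false ∷ b ∷ s) parity-bit
  where
  parity-bit : parity s ≡ a
  parity-bit = begin
    parity s                      ≡⟨ cong (_xor parity s) even ⟨
    (a xor parity s) xor parity s ≡⟨ xor-assoc a (parity s) (parity s) ⟩
    a xor (parity s xor parity s) ≡⟨ cong (a xor_) (xor-same (parity s)) ⟩
    a xor false                   ≡⟨ xor-identityʳ a ⟩
    a                             ∎
    where open ≡-Reasoning

funToFin-cong : ∀ {m n} {f g : Fin m → Fin n} → (∀ t → f t ≡ g t) →
  funToFin f ≡ funToFin g
funToFin-cong {zero}  eq = refl
funToFin-cong {suc m} eq = cong₂ combine (eq zero) (funToFin-cong (eq ∘ suc))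

bits↔ : ∀ m → Fin (2 ^ m) ↔ Vec Bool m
bits↔ m = mk↔ₛ′ toBits fromBits toBits∘fromBits fromBits∘toBits
  where
  open Inverse 2↔Bool using (to; from; strictlyInverseˡ; strictlyInverseʳ)
  toBits : Fin (2 ^ m) → Vec Bool m
  toBits i = tabulate (to ∘ finToFun i)
  fromBits : Vec Bool m → Fin (2 ^ m)
  fromBits s = funToFin (from ∘ lookup s)
  toBits∘fromBits : ∀ s → toBits (fromBits s) ≡ s
  toBits∘fromBits s = lookup-ext λ t →
    trans (lookup∘tabulate (to ∘ finToFun (fromBits s)) t)
          (trans (cong to (finToFun-funToFin (from ∘ lookup s) t)) (strictlyInverseˡ (lookup s t)))
  fromBits∘toBits : ∀ i → fromBits (toBits i) ≡ i
  fromBits∘toBits i = trans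
    (funToFin-cong {m} λ t →
      trans (cong from (lookup∘tabulate (to ∘ finToFun i) t)) (strictlyInverseʳ (finToFun i t)))
    (funToFin-finToFin {m} i)

divides-by-family : ∀ {n L r} {w : ℕ → Subset n} {I : Set} (index : Fin r ↔ I)
  (θ : I → Subset n → Subset n) →
  (∀ a → Embedding L w (θ a)) →
  (∀ x y → Adj x y → ∃[ a ] EdgeIn L w (θ a) x y) →
  (∀ x y a a′ → EdgeIn L w (θ a) x y → EdgeIn L w (θ a′) x y → a ≡ a′) →
  DividesQ n L w
divides-by-family {n} {L} {r} {w} index θ embedding cover unique =
  r , θ ∘ to , embedding ∘ to , λ x y adj → covered x y adj , λ i i′ e e′ →
    trans (sym (strictlyInverseʳ i))
          (trans (cong from (unique x y (to i) (to i′) e e′)) (strictlyInverseʳ i′))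
  where
  open Inverse index using (to; from; strictlyInverseˡ; strictlyInverseʳ)
  covered : ∀ x y → Adj x y → ∃[ i ] EdgeIn L w (θ (to i)) x y
  covered x y adj with cover x y adj
  ... | a , edge = from a , subst (λ b → EdgeIn L w (θ b) x y) (sym (strictlyInverseˡ a)) edge

module OffsetDecomposition {n} (F : Subset (suc n))
         (F-zero : lookup F zero ≡ true) (F-even : parity F ≡ false) where

  offset : Bool → Subset (suc n)
  offset false = ⊥
  offset true  = F

  lookup-offset : ∀ a → lookup (offset a) zero ≡ a
  lookup-offset false = refl
  lookup-offset true  = F-zero

  parity-offset : ∀ a → parity (offset a) ≡ false
  parity-offset false = parity-⊥ (suc n)
  parity-offset true  = F-even

  lookup-translate : ∀ {c} → Canonical c → ∀ a → lookup (c Δ offset a) zero ≡ a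
  lookup-translate {c} (c₀≡false , _) a = begin
    lookup (c Δ offset a) zero               ≡⟨ lookup-Δ c (offset a) zero ⟩
    lookup c zero xor lookup (offset a) zero ≡⟨ cong₂ _xor_ c₀≡false (lookup-offset a) ⟩
    false xor a                              ≡⟨⟩
    a                                        ∎
    where open ≡-Reasoning

  decompose : ∀ v → parity v ≡ false → ∃[ c ] ∃[ a ] Canonical c × c Δ offset a ≡ v
  decompose v v-even = v Δ offset a , a , (c₀≡false , c-even) , Δ-cancelʳ v (offset a)
    where
    a : Bool
    a = lookup v zero
    c₀≡false : lookup (v Δ offset a) zero ≡ false
    c₀≡false = trans (lookup-Δ v (offset a) zero)
                     (trans (cong (a xor_) (lookup-offset a)) (xor-same a))
    c-even : parity (v Δ offset a) ≡ false
    c-even = trans (parity-Δ v (offset a)) (cong₂ _xor_ v-even (parity-offset a))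

  decompose-unique : ∀ {c c′ a a′} → Canonical c → Canonical c′ →
    c Δ offset a ≡ c′ Δ offset a′ → c ≡ c′
  decompose-unique {c} {c′} {a} {a′} c-can c′-can eq =
    Δ-injectiveʳ (offset a) c c′ (trans eq (cong (λ b → c′ Δ offset b) (sym a≡a′)))
    where
    a≡a′ : a ≡ a′
    a≡a′ = trans (sym (lookup-translate {c} c-can a))
                 (trans (cong (λ v → lookup v zero) eq) (lookup-translate {c′} c′-can a′))

module Cycle (q h : ℕ) (k≤n : suc h * 2 ≤ suc q * (suc h * 2)) where
  k n m L : ℕ
  k = suc h * 2
  n = suc q * k
  m = h * 2 + q * k   -- n reduces to 2 + m: m coordinates of a canonical vertex are free
  L = 2 * k

  dir : ℕ → Fin n
  dir = cDir n k k≤n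

  w : ℕ → Subset n
  w = cWalk n k k≤n

  F : Subset n
  F = w k

  pos : ℕ → Fin k
  pos j = fromℕ< (m%n<n j k)

  toℕ-pos : ∀ j → toℕ (pos j) ≡ j % k
  toℕ-pos j = toℕ-fromℕ< (m%n<n j k)

  dir≡pos : ∀ j → dir j ≡ combine {suc q} zero (pos j)
  dir≡pos j = toℕ-injective (begin
    toℕ (dir j)                        ≡⟨ toℕ-fromℕ< _ ⟩
    j % k                              ≡⟨ toℕ-pos j ⟨
    toℕ (pos j)                        ≡⟨ toℕ-↑ˡ (pos j) (q * k) ⟨
    toℕ (combine {suc q} zero (pos j)) ∎)
    where open ≡-Reasoning

  dir-periodic : ∀ j → dir (j + k) ≡ dir j
  dir-periodic j = toℕ-injective (begin
    toℕ (dir (j + k)) ≡⟨ toℕ-fromℕ< _ ⟩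
    (j + k) % k       ≡⟨ [m+n]%n≡m%n j k ⟩
    j % k             ≡⟨ toℕ-fromℕ< _ ⟨
    toℕ (dir j)       ∎)
    where open ≡-Reasoning

  step : Fin k → Bool → ℕ
  step p false = toℕ p
  step p true  = toℕ p + k

  step<L : ∀ p a → step p a < L
  step<L p false = <-≤-trans (toℕ<n p) (m≤m+n k (k + 0))
  step<L p true  =
    subst (toℕ p + k <_) (cong (k +_) (sym (+-identityʳ k))) (+-monoˡ-< k (toℕ<n p))

  pos-step : ∀ p a → pos (step p a) ≡ p
  pos-step p a = toℕ-injective (trans (toℕ-pos (step p a)) (residue a))
    where
    residue : ∀ a → step p a % k ≡ toℕ p
    residue false = m<n⇒m%n≡m (toℕ<n p)
    residue true  = trans ([m+n]%n≡m%n (toℕ p) k) (m<n⇒m%n≡m (toℕ<n p))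

  step-of-pos : ∀ j → j < L → ∃[ a ] j ≡ step (pos j) a
  step-of-pos j j<L with j <? k
  ... | yes j<k = false , sym (trans (toℕ-pos j) (m<n⇒m%n≡m j<k))
  ... | no  j≮k = true , (begin
    j               ≡⟨ i+k≡j ⟨
    i + k           ≡⟨ cong (_+ k) (m<n⇒m%n≡m i<k) ⟨
    i % k + k       ≡⟨ cong (_+ k) ([m+n]%n≡m%n i k) ⟨
    (i + k) % k + k ≡⟨ cong (λ l → l % k + k) i+k≡j ⟩
    j % k + k       ≡⟨ cong (_+ k) (toℕ-pos j) ⟨
    toℕ (pos j) + k ∎)
    where
    open ≡-Reasoning
    i : ℕ
    i = j ∸ k
    i+k≡j : i + k ≡ j
    i+k≡j = m∸n+n≡m (≮⇒≥ j≮k)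
    i<k : i < k
    i<k = +-cancelʳ-< k i k
            (subst (_< k + k) (sym i+k≡j) (subst (λ l → j < k + l) (+-identityʳ k) j<L))

  -- Coordinate 0 is flipped at step 0 and at no other of the first k steps.
  w-zero : ∀ j → j < k → lookup (w (suc j)) zero ≡ true
  w-zero zero    _    = refl
  w-zero (suc j) sj<k = begin
    lookup (w (suc j) Δ ⁅ dir (suc j) ⁆) zero
      ≡⟨ lookup-Δ (w (suc j)) ⁅ dir (suc j) ⁆ zero ⟩
    lookup (w (suc j)) zero xor lookup ⁅ dir (suc j) ⁆ zero
      ≡⟨ cong₂ _xor_ (w-zero j (<-trans (n<1+n j) sj<k)) (lookup-⁅⁆ (dir (suc j)) zero) ⟩
    true xor does (dir (suc j) ≟ zero)
      ≡⟨ cong (true xor_) (dec-false (dir (suc j) ≟ zero) dir≢zero) ⟩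
    true ∎
    where
    open ≡-Reasoning
    dir≢zero : dir (suc j) ≢ zero
    dir≢zero eq = 0≢1+n (trans (sym (cong toℕ eq)) (trans (toℕ-fromℕ< _) (m<n⇒m%n≡m sj<k)))

  F-zero : lookup F zero ≡ true
  F-zero = w-zero (suc (h * 2)) (n<1+n _)

  F-even : parity F ≡ false
  F-even = trans (parity-walk-even ⊥ dir (suc h)) (parity-⊥ n)

  open OffsetDecomposition F F-zero F-even

  w-step : ∀ p a → w (step p a) ≡ w (toℕ p) Δ offset a
  w-step p false = sym (Δ-identityʳ (w (toℕ p)))
  w-step p true  = walk-shift dir k dir-periodic (toℕ p)

  translate-step : ∀ c p a → c Δ w (step p a) ≡ (c Δ offset a) Δ w (toℕ p)
  translate-step c p a = begin
    c Δ w (step p a)           ≡⟨ cong (c Δ_) (w-step p a) ⟩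
    c Δ (w (toℕ p) Δ offset a) ≡⟨ Δ-assoc c (w (toℕ p)) (offset a) ⟨
    (c Δ w (toℕ p)) Δ offset a ≡⟨ Δ-swapʳ c (w (toℕ p)) (offset a) ⟩
    (c Δ offset a) Δ w (toℕ p) ∎
    where open ≡-Reasoning

  -- In a canonical translate of C, the parity of the vertex at time j depends only
  -- on pos j (because k is even).
  parity-class : ∀ {c} → Canonical c → ∀ j → j < L →
    parity (c Δ w j) ≡ parity (w (toℕ (pos j)))
  parity-class {c} c-can j j<L with step-of-pos j j<L
  ... | a , j≡step = begin
    parity (c Δ w j)                             ≡⟨ cong (λ l → parity (c Δ w l)) j≡step ⟩
    parity (c Δ w (step p a))                    ≡⟨ cong parity (translate-step c p a) ⟩
    parity ((c Δ offset a) Δ w (toℕ p))          ≡⟨ parity-Δ (c Δ offset a) (w (toℕ p)) ⟩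
    parity (c Δ offset a) xor parity (w (toℕ p)) ≡⟨ cong (_xor parity (w (toℕ p))) c+a-even ⟩
    parity (w (toℕ p))                           ∎
    where
    open ≡-Reasoning
    p : Fin k
    p = pos j
    c+a-even : parity (c Δ offset a) ≡ false
    c+a-even = trans (parity-Δ c (offset a)) (cong₂ _xor_ (proj₂ c-can) (parity-offset a))

  translates-disjoint : ∀ {c c′} → Canonical c → Canonical c′ → ∀ j j′ → j < L → j′ < L →
    pos j ≡ pos j′ → c Δ w j ≡ c′ Δ w j′ → c ≡ c′
  translates-disjoint {c} {c′} c-can c′-can j j′ j<L j′<L pj≡pj′ eq
    with step-of-pos j j<L | step-of-pos j′ j′<L
  ... | a , j≡step | a′ , j′≡step = decompose-unique {a = a} {a′} c-can c′-can
    (Δ-injectiveʳ (w (toℕ p)) (c Δ offset a) (c′ Δ offset a′) (begin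
      (c Δ offset a) Δ w (toℕ p)   ≡⟨ translate-step c p a ⟨
      c Δ w (step p a)             ≡⟨ cong (λ l → c Δ w l) j≡step ⟨
      c Δ w j                      ≡⟨ eq ⟩
      c′ Δ w j′                    ≡⟨ cong (λ l → c′ Δ w l) j′≡step ⟩
      c′ Δ w (step (pos j′) a′)    ≡⟨ cong (λ r → c′ Δ w (step r a′)) pj≡pj′ ⟨
      c′ Δ w (step p a′)           ≡⟨ translate-step c′ p a′ ⟩
      (c′ Δ offset a′) Δ w (toℕ p) ∎))
    where
    open ≡-Reasoning
    p : Fin k
    p = pos j

  swap : Fin (suc q) → Permutation′ n
  swap b = blockPerm k (transpose zero b)

  swap-dir : ∀ b j → swap b ⟨$⟩ʳ dir j ≡ combine b (pos j)
  swap-dir b j =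
    trans (cong (swap b ⟨$⟩ʳ_) (dir≡pos j)) (blockPerm-combine k (transpose zero b) zero (pos j))

  dir-step : ∀ p a → dir (step p a) ≡ dir (toℕ p)
  dir-step p false = refl
  dir-step p true  = dir-periodic (toℕ p)

  swap-step : ∀ b p a → swap b ⟨$⟩ʳ dir (step p a) ≡ combine b p
  swap-step b p a = trans (swap-dir b (step p a)) (cong (combine b) (pos-step p a))

  -- The copies of C: one for every block b and every canonical translation vector,
  -- which is described by its free coordinates.
  Index : Set
  Index = Fin (suc q) × Vec Bool m

  index : Fin (suc q * 2 ^ m) ↔ Index
  index = (↔-id _ ×-↔ bits↔ m) ↔-∘ *↔×

  copy : Index → Subset n → Subset n
  copy (b , s) = aut (swap b) (canon s)

  on-translate : ∀ z p → parity z ≡ parity (w (toℕ p)) →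
    ∃[ s ] ∃[ a ] canon s Δ w (step p a) ≡ z
  on-translate z p z-par = translate (decompose v v-even)
    where
    v : Subset n
    v = z Δ w (toℕ p)
    v-even : parity v ≡ false
    v-even = trans (parity-Δ z (w (toℕ p)))
                   (trans (cong (_xor parity (w (toℕ p))) z-par) (xor-same (parity (w (toℕ p)))))
    translate : (∃[ c ] ∃[ a ] Canonical c × c Δ offset a ≡ v) →
      ∃[ s ] ∃[ a ] canon s Δ w (step p a) ≡ z
    translate (c , a , c-can , c+a≡v) = s , a , (begin
      canon s Δ w (step p a)           ≡⟨ translate-step (canon s) p a ⟩
      (canon s Δ offset a) Δ w (toℕ p) ≡⟨ cong (λ c′ → (c′ Δ offset a) Δ w (toℕ p)) s≡c ⟩
      (c Δ offset a) Δ w (toℕ p)       ≡⟨ cong (_Δ w (toℕ p)) c+a≡v ⟩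
      v Δ w (toℕ p)                    ≡⟨ Δ-cancelʳ z (w (toℕ p)) ⟩
      z                                ∎)
      where
      open ≡-Reasoning
      s : Vec Bool m
      s = proj₁ (canonical⇒canon c c-can)
      s≡c : canon s ≡ c
      s≡c = proj₂ (canonical⇒canon c c-can)

  -- The edge at x in direction (block b, position p) lies in a copy of block b: pull it
  -- back to block 0, take its endpoint z with the parity of C's vertex at time p, and
  -- the canonical translate of C through z.
  cover-edge : ∀ x b p → ∃[ i ] EdgeIn L w (copy i) x (x Δ ⁅ combine b p ⁆)
  cover-edge x b p = (b , s) ,
    aut-edge⁺ L ⊥ dir (swap b) (canon s) x (x Δ ⁅ combine b p ⁆) (step p a)
      (step<L p a , cong (λ e → x Δ ⁅ e ⁆) (sym (swap-step b p a)) ,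
       subst₂ (Endpoint u) (sym (dir-step p a)) (sym hits-z) z-end)
    where
    u : Subset n
    u = act (flip (swap b)) x
    endpoint : ∃[ z ] Endpoint u (dir (toℕ p)) z × parity z ≡ parity (w (toℕ p))
    endpoint = endpoint-of-parity u (dir (toℕ p)) (parity (w (toℕ p)))
    z : Subset n
    z = proj₁ endpoint
    z-end : Endpoint u (dir (toℕ p)) z
    z-end = proj₁ (proj₂ endpoint)
    translate : ∃[ s ] ∃[ a ] canon s Δ w (step p a) ≡ z
    translate = on-translate z p (proj₂ (proj₂ endpoint))
    s : Vec Bool m
    s = proj₁ translate
    a : Bool
    a = proj₁ (proj₂ translate)
    hits-z : canon s Δ w (step p a) ≡ z
    hits-z = proj₂ (proj₂ translate)

  cover : ∀ x y → Adj x y → ∃[ i ] EdgeIn L w (copy i) x y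
  cover x y adj = subst (λ y′ → ∃[ i ] EdgeIn L w (copy i) x y′) (sym y≡x+d)
    (subst (λ e → ∃[ i ] EdgeIn L w (copy i) x (x Δ ⁅ e ⁆)) (combine-remQuot {suc q} k d)
      (cover-edge x (proj₁ (remQuot {suc q} k d)) (proj₂ (remQuot {suc q} k d))))
    where
    d : Fin n
    d = proj₁ (adj⇒step x y adj)
    y≡x+d : y ≡ x Δ ⁅ d ⁆
    y≡x+d = proj₂ (adj⇒step x y adj)

  -- Copies in the same block traversing an edge at steps of the same position
  -- coincide: parity determines the endpoint, and then coordinate 0 the translate.
  same-translate : ∀ {x y b s s′ j j′} →
    Traverses L ⊥ dir (swap b) (canon s) x y j →
    Traverses L ⊥ dir (swap b) (canon s′) x y j′ →
    pos j ≡ pos j′ → s ≡ s′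
  same-translate {x} {y} {b} {s} {s′} {j} {j′} (j<L , _ , end) (j′<L , _ , end′) pj≡pj′ =
    canon-injective
      (translates-disjoint (canon-canonical s) (canon-canonical s′) j j′ j<L j′<L pj≡pj′ same-vertex)
    where
    dir-j′ : dir j′ ≡ dir j
    dir-j′ = trans (dir≡pos j′) (trans (cong (combine {suc q} zero) (sym pj≡pj′)) (sym (dir≡pos j)))
    same-parity : parity (canon s Δ w j) ≡ parity (canon s′ Δ w j′)
    same-parity = trans (parity-class (canon-canonical s) j j<L)
      (trans (cong (parity ∘ w ∘ toℕ) pj≡pj′) (sym (parity-class (canon-canonical s′) j′ j′<L)))
    same-vertex : canon s Δ w j ≡ canon s′ Δ w j′
    same-vertex = endpoint-unique end
      (subst (λ e → Endpoint (act (flip (swap b)) x) e (canon s′ Δ w j′)) dir-j′ end′) same-parity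

  -- No edge lies in two copies: its direction determines the block and the position
  -- of the traversing step of C.
  unique : ∀ x y i i′ → EdgeIn L w (copy i) x y → EdgeIn L w (copy i′) x y → i ≡ i′
  unique x y (b , s) (b′ , s′) edge edge′ = cong₂ _,_ b≡b′
    (same-translate t (subst (λ b″ → Traverses L ⊥ dir (swap b″) (canon s′) x y j′) (sym b≡b′) t′)
                    pj≡pj′)
    where
    traversal : ∃[ j ] Traverses L ⊥ dir (swap b) (canon s) x y j
    traversal = aut-edge⁻ L ⊥ dir (swap b) (canon s) x y edge
    traversal′ : ∃[ j′ ] Traverses L ⊥ dir (swap b′) (canon s′) x y j′
    traversal′ = aut-edge⁻ L ⊥ dir (swap b′) (canon s′) x y edge′
    j j′ : ℕ
    j = proj₁ traversal
    j′ = proj₁ traversal′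
    t : Traverses L ⊥ dir (swap b) (canon s) x y j
    t = proj₂ traversal
    t′ : Traverses L ⊥ dir (swap b′) (canon s′) x y j′
    t′ = proj₂ traversal′
    same-direction : combine b (pos j) ≡ combine b′ (pos j′)
    same-direction = begin
      combine b (pos j)   ≡⟨ swap-dir b j ⟨
      swap b ⟨$⟩ʳ dir j   ≡⟨ ⁅⁆-injective (Δ-injectiveˡ x D D′ (trans (sym (proj₁ (proj₂ t)))
                                                                    (proj₁ (proj₂ t′)))) ⟩
      swap b′ ⟨$⟩ʳ dir j′ ≡⟨ swap-dir b′ j′ ⟩
      combine b′ (pos j′) ∎
      where
      open ≡-Reasoning
      D D′ : Subset n
      D = ⁅ swap b ⟨$⟩ʳ dir j ⁆
      D′ = ⁅ swap b′ ⟨$⟩ʳ dir j′ ⁆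
    b≡b′ : b ≡ b′
    b≡b′ = proj₁ (combine-injective b (pos j) b′ (pos j′) same-direction)
    pj≡pj′ : pos j ≡ pos j′
    pj≡pj′ = proj₂ (combine-injective b (pos j) b′ (pos j′) same-direction)

  cycle-divides : DividesQ n L w
  cycle-divides = divides-by-family index copy
    (λ (b , s) → aut-embedding L ⊥ dir (swap b) (canon s)) cover unique

-- Write k = 2(h+1) and n = (q+1)k and apply Cycle; q = 0 or h = 0 would make n or k zero.
corollary6 : (n k : ℕ) .{{_ : NonZero n}} .{{_ : NonZero k}} →
    2 ∣ n → 2 ∣ k → (k∣n : k ∣ n) →
    DividesQ n (2 * k) (cWalk n k (∣⇒≤ k∣n))
corollary6 _ _ _ (divides zero    refl) (divides q       refl) = contradiction refl (≢-nonZero⁻¹ 0)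
corollary6 _ _ _ (divides (suc h) refl) (divides zero    refl) = contradiction refl (≢-nonZero⁻¹ 0)
corollary6 _ _ _ (divides (suc h) refl) (divides (suc q) refl) =
  Cycle.cycle-divides q h (∣⇒≤ (divides (suc q) refl))
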